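{- Let $A$ be an overt space and $U$ an open of $A$. Define $\mathsf{simulate}^*(V) = \exists_A(V\wedge U)$ for $V\in\mathcal{O}(A)$. Then $\mathsf{simulate}^*$ yields a well-defined map $\mathcal{O}(\{A\mid U\})\to\mathcal{O}(\{\mathbf{1}\mid\exists_A U\})$ that preserves all joins and $\top$; hence it is the inverse image map of a nondeterministic map $\mathsf{simulate} : \{\mathbf{1}\mid \exists_A U\}\to_{nd}\{A\mid U\}$.
   Context: Work in a constructive metatheory. A space $A$ is given by its lattice of opens $\mathcal{O}(A)$: a distributive lattice with $\top$, $\bot$ and all joins, binary meets distributing over joins. A nondeterministic map $f : B\to_{nd} A$ is a map $f^* : \mathcal{O}(A)\to\mathcal{O}(B)$ preserving all joins and $\top$ (not necessarily binary meets). $\mathbf{1}$ is the one-point space, whose lattice of opens is the lattice of propositions. For an open $U$ of a space $A$, the open subspace $\{A\mid U\}$ has as opens $\mathcal{O}(A)$ modulo $P\sim Q\iff P\wedge U = Q\wedge U$. A space $A$ is overt if for every space $\Gamma$ the map $-\times\top_A : \mathcal{O}(\Gamma)\to\mathcal{O}(\Gamma\times A)$ has a left adjoint $\exists_A$; here it is used with $\Gamma = \mathbf{1}$, giving $\exists_A : \mathcal{O}(A)\to\mathcal{O}(\mathbf{1})$. -}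

module Defs where

open import Level using (Level; _⊔_; suc)
open import Data.Product using (Σ; _×_; _,_; proj₁; proj₂)
open import Data.Unit.Polymorphic using (⊤)
open import Data.Empty.Polymorphic using (⊥)
open import Function using (id; _∘_)

record Frame (c ℓ i : Level) : Set (suc (c ⊔ ℓ ⊔ i)) where
  infix 4 _≤_ _≈_
  infixr 7 _∧_
  field
    Carrier : Set c
    _≤_     : Carrier → Carrier → Set ℓ
    ≤-refl  : ∀ {a} → a ≤ a
    ≤-trans : ∀ {a b d} → a ≤ b → b ≤ d → a ≤ d
    ⊤ᶠ      : Carrier
    ⊥ᶠ      : Carrier
    _∧_     : Carrier → Carrier → Carrier
    ∨ᶠ      : {I : Set i} → (I → Carrier) → Carrier
    ⊤-max   : ∀ {a} → a ≤ ⊤ᶠ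
    ⊥-min   : ∀ {a} → ⊥ᶠ ≤ a
    ∧-lb₁   : ∀ {a b} → a ∧ b ≤ a
    ∧-lb₂   : ∀ {a b} → a ∧ b ≤ b
    ∧-glb   : ∀ {a b d} → d ≤ a → d ≤ b → d ≤ a ∧ b
    ∨-ub    : ∀ {I : Set i} (f : I → Carrier) (k : I) → f k ≤ ∨ᶠ f
    ∨-lub   : ∀ {I : Set i} (f : I → Carrier) {a} → (∀ k → f k ≤ a) → ∨ᶠ f ≤ a
    distrib : ∀ {I : Set i} (a : Carrier) (f : I → Carrier) →
              a ∧ ∨ᶠ f ≤ ∨ᶠ (λ k → a ∧ f k)

  _≈_ : Carrier → Carrier → Set ℓ
  a ≈ b = (a ≤ b) × (b ≤ a)

-- The one-point space 1: its opens are propositions (ordered by implication).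
𝟏 : (i : Level) → Frame (suc i) i i
𝟏 i = record
  { Carrier = Set i
  ; _≤_ = λ P Q → P → Q
  ; ≤-refl = id
  ; ≤-trans = λ f g → g ∘ f
  ; ⊤ᶠ = ⊤
  ; ⊥ᶠ = ⊥
  ; _∧_ = _×_
  ; ∨ᶠ = λ {I} f → Σ I f
  ; ⊤-max = λ _ → _
  ; ⊥-min = λ ()
  ; ∧-lb₁ = proj₁
  ; ∧-lb₂ = proj₂
  ; ∧-glb = λ f g x → f x , g x
  ; ∨-ub = λ f k x → k , x
  ; ∨-lub = λ f h (k , x) → h k x
  ; distrib = λ a f (x , (k , y)) → k , (x , y)
  }

-- Open subspace {A | U}: opens of A modulo P ~ Q iff P ∧ U = Q ∧ U,
-- presented by the order P ≤' Q iff P ∧ U ≤ Q ∧ U (so ≈' is exactly ~).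
OpenSub : ∀ {c ℓ i} (A : Frame c ℓ i) → Frame.Carrier A → Frame c ℓ i
OpenSub A U = record
  { Carrier = Carrier
  ; _≤_ = λ P Q → P ∧ U ≤ Q ∧ U
  ; ≤-refl = ≤-refl
  ; ≤-trans = ≤-trans
  ; ⊤ᶠ = ⊤ᶠ
  ; ⊥ᶠ = ⊥ᶠ
  ; _∧_ = _∧_
  ; ∨ᶠ = ∨ᶠ
  ; ⊤-max = ∧-glb (≤-trans ∧-lb₁ ⊤-max) ∧-lb₂
  ; ⊥-min = ∧-glb (≤-trans ∧-lb₁ ⊥-min) ∧-lb₂
  ; ∧-lb₁ = ∧-glb (≤-trans ∧-lb₁ ∧-lb₁) ∧-lb₂
  ; ∧-lb₂ = ∧-glb (≤-trans ∧-lb₁ ∧-lb₂) ∧-lb₂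
  ; ∧-glb = λ p q → ∧-glb (∧-glb (≤-trans p ∧-lb₁) (≤-trans q ∧-lb₁)) ∧-lb₂
  ; ∨-ub = λ f k → ∧-glb (≤-trans ∧-lb₁ (∨-ub f k)) ∧-lb₂
  ; ∨-lub = λ f {a} h →
      ≤-trans (∧-glb ∧-lb₂ ∧-lb₁)
        (≤-trans (distrib U f)
          (∨-lub _ (λ k → ≤-trans (∧-glb ∧-lb₂ ∧-lb₁) (h k))))
  ; distrib = λ a f → ∧-glb (≤-trans ∧-lb₁ (distrib a f)) ∧-lb₂
  }
  where open Frame A

-- A nondeterministic map f : B →nd A is given by f* : O(A) → O(B), well defined
-- on opens (respects equality of opens) and preserving all joins and ⊤
-- (not necessarily binary meets).
record IsNDInverseImage {cb ℓb ca ℓa i} (B : Frame cb ℓb i) (A : Frame ca ℓa i)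
         (f* : Frame.Carrier A → Frame.Carrier B) : Set (cb ⊔ ℓb ⊔ ca ⊔ ℓa ⊔ suc i) where
  private
    module A = Frame A
    module B = Frame B
  field
    well-defined : ∀ {P Q} → P A.≈ Q → f* P B.≈ f* Q
    pres-∨ : ∀ {I : Set i} (g : I → A.Carrier) → f* (A.∨ᶠ g) B.≈ B.∨ᶠ (λ k → f* (g k))
    pres-⊤ : f* A.⊤ᶠ B.≈ B.⊤ᶠ

-- The map -×⊤_A : O(1) → O(1 × A) ≅ O(A), i.e. p ↦ ⋁_{_ : p} ⊤_A.
−×⊤ : ∀ {c ℓ i} (A : Frame c ℓ i) → Set i → Frame.Carrier A
−×⊤ A p = Frame.∨ᶠ A {I = p} (λ _ → Frame.⊤ᶠ A)

-- ∃_A : O(A) → O(1) is left adjoint to -×⊤_A (overtness, instance Γ = 1).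
record IsExistsLeftAdjoint {c ℓ i} (A : Frame c ℓ i) (∃A : Frame.Carrier A → Set i)
         : Set (c ⊔ ℓ ⊔ suc i) where
  open Frame A
  field
    adj⇒ : ∀ (V : Carrier) (p : Set i) → (∃A V → p) → V ≤ −×⊤ A p
    adj⇐ : ∀ (V : Carrier) (p : Set i) → V ≤ −×⊤ A p → (∃A V → p)

simulate* : ∀ {c ℓ i} (A : Frame c ℓ i) (∃A : Frame.Carrier A → Set i)
            (U : Frame.Carrier A) → Frame.Carrier A → Set i
simulate* A ∃A U V = ∃A (Frame._∧_ A V U)

-- ∃_A is a left adjoint, so it is monotone and preserves all joins; these two facts, together
-- with the distributivity of ∧ U over joins, are all that the inverse image map needs.
module Submission where

open import Level using (Level)
open import Data.Product using (Σ; _,_; map₁)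
open import Function using (id)
open import Defs

module FrameProperties {c ℓ i} (A : Frame c ℓ i) where
  open Frame A

  ∧-comm : ∀ {a b} → a ∧ b ≤ b ∧ a
  ∧-comm = ∧-glb ∧-lb₂ ∧-lb₁

  ∧-monoˡ : ∀ {a b d} → a ≤ b → a ∧ d ≤ b ∧ d
  ∧-monoˡ a≤b = ∧-glb (≤-trans ∧-lb₁ a≤b) ∧-lb₂

  ∧-distribʳ-∨ : ∀ {I : Set i} (f : I → Carrier) (a : Carrier) →
                 ∨ᶠ f ∧ a ≤ ∨ᶠ (λ k → f k ∧ a)
  ∧-distribʳ-∨ f a =
    ≤-trans ∧-comm (≤-trans (distrib a f) (∨-lub _ λ k → ≤-trans ∧-comm (∨-ub (λ k → f k ∧ a) k)))

module LeftAdjointProperties {c ℓ i} (A : Frame c ℓ i) (∃A : Frame.Carrier A → Set i)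
                             (adj : IsExistsLeftAdjoint A ∃A) where
  open Frame A
  open IsExistsLeftAdjoint adj

  unit : ∀ V → V ≤ −×⊤ A (∃A V)
  unit V = adj⇒ V (∃A V) id

  ∃-mono : ∀ {V W} → V ≤ W → ∃A V → ∃A W
  ∃-mono {V} {W} V≤W = adj⇐ V (∃A W) (≤-trans V≤W (unit W))

  ∃-pres-∨ : ∀ {I : Set i} (f : I → Carrier) → ∃A (∨ᶠ f) → Σ I (λ k → ∃A (f k))
  ∃-pres-∨ {I} f = adj⇐ (∨ᶠ f) (Σ I λ k → ∃A (f k))
    (∨-lub f λ k → ≤-trans (unit (f k)) (∨-lub _ λ x → ∨-ub (λ _ → ⊤ᶠ) (k , x)))

restrict : ∀ {i} {p q : Set i} (s : Set i) → (p → q) → Frame._≤_ (OpenSub (𝟏 i) s) p q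
restrict s p→q = map₁ p→q

proposition6p3 : ∀ {c ℓ i : Level} (A : Frame c ℓ i)
                   (∃A : Frame.Carrier A → Set i) → IsExistsLeftAdjoint A ∃A →
                   (U : Frame.Carrier A) →
                   IsNDInverseImage (OpenSub (𝟏 i) (∃A U)) (OpenSub A U) (simulate* A ∃A U)
proposition6p3 A ∃A adj U = record
  { well-defined = λ (P≤Q , Q≤P) → restrict (∃A U) (∃-mono P≤Q) , restrict (∃A U) (∃-mono Q≤P)
  ; pres-∨       = λ g → restrict (∃A U) (λ x → ∃-pres-∨ _ (∃-mono (∧-distribʳ-∨ g U) x))
                       , restrict (∃A U) (λ (k , x) → ∃-mono (∧-monoˡ (∨-ub g k)) x)
  ; pres-⊤       = restrict (∃A U) _
                 , λ (_ , u) → ∃-mono (∧-glb ⊤-max ≤-refl) u , u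
  }
  where
  open Frame A
  open FrameProperties A
  open LeftAdjointProperties A ∃A adj
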